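{- Let $n\ge 2$, $k\ge 1$, and let $\pi$ be an even permutation of the vertex set $\{0,\dots,k+1\}$ of $K_{k+2}$. Then $c_{n,k}\simeq \pi\circ c_{n,k}$ as graph homomorphisms $\overline{SG}_{n,k}\to K_{k+2}$.
   Context: For $n\ge1$, $k\ge0$, $m=2n+k$: a subset $S\subseteq\{0,\dots,m-1\}$ is semi-stable if $\{i,i+1\}\not\subseteq S$ for all $0\le i\le m-2$. The semi-stable Kneser graph $\overline{SG}_{n,k}$ has as vertices the semi-stable $n$-element subsets of $\{0,\dots,m-1\}$, two adjacent iff disjoint. $K_{k+2}$ is the complete graph on $\{0,\dots,k+1\}$. The canonical colouring $c_{n,k}\colon\overline{SG}_{n,k}\to K_{k+2}$ is $S\mapsto\min S$. For graphs $G,H$ (possibly with loops), and maps $f,g\colon V(G)\to V(H)$, write $f\sim g$ if $(f(u),g(v))\in E(H)$ for all $(u,v)\in E(G)$. For graph homomorphisms $f,g\colon G\to H$, $f\simeq g$ means there exist $N\ge0$ and maps $f=p_0,p_1,\dots,p_N=g$ from $V(G)$ to $V(H)$ with $p_i\sim p_i$ for all $i$ (i.e. each $p_i$ is a homomorphism) and $p_{i}\sim p_{i+1}$ for $0\le i<N$. -}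

module Defs where

open import Data.Nat using (ℕ; zero; suc; _+_; _*_; _<_; _<?_)
open import Data.Bool using (Bool; true; false)
open import Data.Fin using (Fin; toℕ; fromℕ<)
open import Data.Fin.Patterns using (0F)
open import Data.Fin.Subset using (Subset; inside; outside; ∣_∣; Empty)
open import Data.Fin.Permutation using (Permutation′; _⟨$⟩ʳ_)
open import Data.Fin.Permutation.Transposition.List using (TranspositionList; eval)
open import Data.List using (List; length)
open import Data.List.Relation.Unary.All using (All)
open import Data.Nat.Divisibility using (_∣_)
open import Data.Unit using (⊤)
open import Data.Empty using (⊥)
open import Data.Product using (Σ; ∃; _×_; _,_; proj₁; proj₂)
open import Data.Vec using (Vec; []; _∷_)
open import Relation.Binary.PropositionalEquality using (_≡_; _≢_)
open import Relation.Nullary using (¬_; yes; no)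

record Graph : Set₁ where
  field
    V : Set
    E : V → V → Set
open Graph public

Rel∼ : (G H : Graph) → (V G → V H) → (V G → V H) → Set
Rel∼ G H f g = ∀ u v → E G u v → E H (f u) (g v)

IsHom : (G H : Graph) → (V G → V H) → Set
IsHom G H f = Rel∼ G H f f

data Chain (G H : Graph) : (V G → V H) → (V G → V H) → Set where
  done : ∀ {f g} → IsHom G H f → (∀ x → f x ≡ g x) → Chain G H f g
  step : ∀ {f g} (p : V G → V H) → IsHom G H f → Rel∼ G H f p
       → Chain G H p g → Chain G H f g

Homotopic : (G H : Graph) → (V G → V H) → (V G → V H) → Set
Homotopic = Chain

K : ℕ → Graph
K r = record { V = Fin r ; E = λ i j → i ≢ j }

-- semi-stable: no two consecutive elements i, i+1 (0 ≤ i ≤ m-2)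
SemiStable : ∀ {m} → Subset m → Set
SemiStable []                         = ⊤
SemiStable (inside ∷ inside ∷ s)      = ⊥
SemiStable (inside ∷ outside ∷ s)     = SemiStable (outside ∷ s)
SemiStable (inside ∷ [])              = ⊤
SemiStable (outside ∷ s)              = SemiStable s

Disjoint : ∀ {m} → Subset m → Subset m → Set
Disjoint [] [] = ⊤
Disjoint (inside ∷ s) (inside ∷ t) = ⊥
Disjoint (inside ∷ s) (outside ∷ t) = Disjoint s t
Disjoint (outside ∷ s) (_ ∷ t) = Disjoint s t

SGVertex : ℕ → ℕ → Set
SGVertex n k = Σ (Subset (2 * n + k)) λ S → (∣ S ∣ ≡ n) × SemiStable S

SG : ℕ → ℕ → Graph
SG n k = record { V = SGVertex n k ; E = λ S T → Disjoint (proj₁ S) (proj₁ T) }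

-- minimum of a subset, as a natural number (returns m for the empty set)
minℕ : ∀ {m} → Subset m → ℕ
minℕ {zero}  []            = zero
minℕ {suc m} (inside ∷ s)  = zero
minℕ {suc m} (outside ∷ s) = suc (minℕ s)

-- canonical colouring c_{n,k} : S ↦ min S ∈ {0,…,k+1}.
-- For every vertex min S ≤ k+1 holds, so the fallback value 0 is never
-- used; it only avoids carrying the bound proof.
c : (n k : ℕ) → SGVertex n k → Fin (2 + k)
c n k S with minℕ (proj₁ S) <? 2 + k
... | yes p = fromℕ< p
... | no _  = 0F

IsEvenPerm : ∀ {r} → Permutation′ r → Set
IsEvenPerm {r} π =
  Σ (TranspositionList r) λ ts →
    All (λ t → proj₁ t ≢ proj₂ t) ts × 2 ∣ length ts ×
    (∀ i → eval ts ⟨$⟩ʳ i ≡ π ⟨$⟩ʳ i)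

module Submission where

-- Call a colouring f invariant under a permutation σ of the colours when f ≃ σ ∘ f. Invariant
-- permutations are closed under composition and an even permutation is a product of double
-- transpositions, so it suffices that every min-colouring of SG̅_{n,k} is invariant under all
-- double transpositions.
--
-- For k = 1, sending a set to its two smallest elements is a homomorphism onto SG̅_{2,1} (a
-- 5-cycle with a pendant vertex) through which the min-colouring factors, and there an explicit
-- chain of five steps turns the min-colouring into its composite with the rotation ρ of K₃;
-- every double transposition of three colours is a power of ρ.
--
-- For k + 1, the vertices avoiding the last point form a copy of SG̅_{n,k}, and those containing
-- it are pairwise non-disjoint. Colouring the latter by the new top colour and the former by the
-- min-colouring of SG̅_{n,k} gives a map one step away from f on either side, so invariance
-- under a double transposition of SG̅_{n,k}'s colours lifts to the same permutation fixing the
-- top colour t. Deleting the first point instead lifts the double transpositions fixing 0.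
-- Every double transposition is (a b)(1 2) · (1 2)(c d), and each factor fixes 0 or t unless
-- it is (0 t)(1 2), which is a conjugate of one fixing 0 by one fixing t.

open import Defs
open import Data.Nat using (ℕ; zero; suc; _+_; _*_; _≤_; _<_; z≤n; s≤s; _≤?_; _<?_)
import Data.Nat.Properties as ℕₚ
open import Data.Nat.Tactic.RingSolver using (solve-∀)
open import Data.Nat.Divisibility using (_∣_; ∣1⇒≡1; ∣m+n∣m⇒∣n; ∣-refl)
open import Data.Fin as Fin using (Fin; toℕ; fromℕ; fromℕ<; inject₁)
open import Data.Fin.Patterns using (0F; 1F; 2F)
import Data.Fin.Properties as Finₚ
open import Data.Fin.Relation.Unary.Top using (view; ‵fromℕ; ‵inject₁)
open import Data.Fin.Permutation using (Permutation′; _⟨$⟩ʳ_; _∘ₚ_; _≈_; id; transpose)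
import Data.Fin.Permutation.Components as PC
open import Data.Fin.Permutation.Transposition.List using (eval)
open import Data.Fin.Subset using (Subset; inside; outside; ∣_∣)
open import Data.Vec using ([]; _∷_; last; init; lookup)
open import Data.List using ([]; _∷_; length)
import Data.List.Relation.Unary.All as List
open import Data.Maybe using (Maybe; just; nothing; maybe′)
open import Data.Maybe.Relation.Unary.All as Maybe using (just; nothing)
open import Data.Product using (Σ; ∃-syntax; _×_; _,_; proj₁; proj₂)
open import Data.Sum using (_⊎_; inj₁; inj₂)
open import Data.Unit using (⊤; tt)
open import Data.Empty using (⊥; ⊥-elim)
open import Function using (_∘_)
open import Function.Bundles using (Injection)
open import Function.Definitions using (Injective)
open import Function.Properties.Inverse using (↔⇒↣)
open import Relation.Nullary using (¬_; yes; no)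
open import Relation.Nullary.Decidable
  using (Dec; True; toWitness; from-yes; dec-true; dec-false; toSum; ¬?; _×-dec_; _⊎-dec_; _→-dec_)
open import Relation.Binary.PropositionalEquality

module _ {G H : Graph} where

  Rel∼-resp : ∀ {f f′ g g′ : V G → V H} → f ≗ f′ → g ≗ g′ → Rel∼ G H f g → Rel∼ G H f′ g′
  Rel∼-resp f≗f′ g≗g′ f∼g u v uv = subst₂ (E H) (f≗f′ u) (g≗g′ v) (f∼g u v uv)

  IsHom-resp : ∀ {f f′ : V G → V H} → f ≗ f′ → IsHom G H f → IsHom G H f′
  IsHom-resp f≗f′ = Rel∼-resp f≗f′ f≗f′

  chain-homˡ : ∀ {f g} → Chain G H f g → IsHom G H f
  chain-homˡ (done f-hom _)   = f-hom
  chain-homˡ (step _ f-hom _ _) = f-hom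

  chain-respˡ : ∀ {f f′ g} → f ≗ f′ → Chain G H f g → Chain G H f′ g
  chain-respˡ f≗f′ (done f-hom f≗g) = done (IsHom-resp f≗f′ f-hom) (λ x → trans (sym (f≗f′ x)) (f≗g x))
  chain-respˡ f≗f′ (step p f-hom f∼p c) =
    step p (IsHom-resp f≗f′ f-hom) (Rel∼-resp f≗f′ (λ _ → refl) f∼p) c

  chain-respʳ : ∀ {f g g′} → g ≗ g′ → Chain G H f g → Chain G H f g′
  chain-respʳ g≗g′ (done f-hom f≗g)     = done f-hom (λ x → trans (f≗g x) (g≗g′ x))
  chain-respʳ g≗g′ (step p f-hom f∼p c) = step p f-hom f∼p (chain-respʳ g≗g′ c)

  chain-trans : ∀ {f g h} → Chain G H f g → Chain G H g h → Chain G H f h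
  chain-trans (done _ f≗g)         c′ = chain-respˡ (sym ∘ f≗g) c′
  chain-trans (step p f-hom f∼p c) c′ = step p f-hom f∼p (chain-trans c c′)

  chain-single : ∀ {f g} → IsHom G H f → IsHom G H g → Rel∼ G H f g → Chain G H f g
  chain-single f-hom g-hom f∼g = step _ f-hom f∼g (done g-hom (λ _ → refl))

module _ {G H H′ : Graph} {φ : V H → V H′} (φ-hom : IsHom H H′ φ) where

  ∼-postcompose : ∀ {f g : V G → V H} → Rel∼ G H f g → Rel∼ G H′ (φ ∘ f) (φ ∘ g)
  ∼-postcompose f∼g u v uv = φ-hom _ _ (f∼g u v uv)

  chain-postcompose : ∀ {f g : V G → V H} → Chain G H f g → Chain G H′ (φ ∘ f) (φ ∘ g)
  chain-postcompose (done f-hom f≗g)     = done (∼-postcompose f-hom) (cong φ ∘ f≗g)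
  chain-postcompose (step p f-hom f∼p c) =
    step (φ ∘ p) (∼-postcompose f-hom) (∼-postcompose f∼p) (chain-postcompose c)

module _ {G′ G H : Graph} {h : V G′ → V G} (h-hom : IsHom G′ G h) where

  ∼-precompose : ∀ {f g : V G → V H} → Rel∼ G H f g → Rel∼ G′ H (f ∘ h) (g ∘ h)
  ∼-precompose f∼g u v uv = f∼g _ _ (h-hom u v uv)

  chain-precompose : ∀ {f g : V G → V H} → Chain G H f g → Chain G′ H (f ∘ h) (g ∘ h)
  chain-precompose (done f-hom f≗g)     = done (∼-precompose f-hom) (f≗g ∘ h)
  chain-precompose (step p f-hom f∼p c) =
    step (p ∘ h) (∼-precompose f-hom) (∼-precompose f∼p) (chain-precompose c)

permutation-isHom : ∀ {r} (σ : Permutation′ r) → IsHom (K r) (K r) (σ ⟨$⟩ʳ_)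
permutation-isHom σ _ _ a≢b = a≢b ∘ Injection.injective (↔⇒↣ σ)

module _ {r : ℕ} where

  open PC using (transpose-inverse)

  transpose-sendsˡ : ∀ (i j : Fin r) → PC.transpose i j i ≡ j
  transpose-sendsˡ i j rewrite dec-true (i Finₚ.≟ i) refl = refl

  transpose-sendsʳ : ∀ (i j : Fin r) → PC.transpose i j j ≡ i
  transpose-sendsʳ i j with toSum (j Finₚ.≟ i)
  ... | inj₁ refl = transpose-sendsˡ i i
  ... | inj₂ j≢i rewrite dec-false (j Finₚ.≟ i) j≢i | dec-true (j Finₚ.≟ j) refl = refl

  transpose-fixes : ∀ {i j k : Fin r} → k ≢ i → k ≢ j → PC.transpose i j k ≡ k
  transpose-fixes {i} {j} {k} k≢i k≢j rewrite dec-false (k Finₚ.≟ i) k≢i | dec-false (k Finₚ.≟ j) k≢j = refl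

  transpose-comm : ∀ (i j k : Fin r) → PC.transpose i j k ≡ PC.transpose j i k
  transpose-comm i j k with toSum (k Finₚ.≟ i) | toSum (k Finₚ.≟ j)
  ... | inj₁ refl | inj₁ refl = refl
  ... | inj₁ refl | inj₂ k≢j  = trans (transpose-sendsˡ k j) (sym (transpose-sendsʳ j k))
  ... | inj₂ k≢i  | inj₁ refl = trans (transpose-sendsʳ i k) (sym (transpose-sendsˡ k i))
  ... | inj₂ k≢i  | inj₂ k≢j  = trans (transpose-fixes k≢i k≢j) (sym (transpose-fixes k≢j k≢i))

  transpose-involutive : ∀ (i j k : Fin r) → PC.transpose i j (PC.transpose i j k) ≡ k
  transpose-involutive i j k = trans (cong (PC.transpose i j) (transpose-comm i j k)) (transpose-inverse i j)

transpose-natural : ∀ {r r′} {ι : Fin r′ → Fin r} → Injective _≡_ _≡_ ι →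
                    ∀ i j k → PC.transpose (ι i) (ι j) (ι k) ≡ ι (PC.transpose i j k)
transpose-natural {ι = ι} ι-injective i j k with toSum (k Finₚ.≟ i) | toSum (k Finₚ.≟ j)
... | inj₁ refl | _ = trans (transpose-sendsˡ (ι k) (ι j)) (cong ι (sym (transpose-sendsˡ k j)))
... | inj₂ k≢i | inj₁ refl = trans (transpose-sendsʳ (ι i) (ι k)) (cong ι (sym (transpose-sendsʳ i k)))
... | inj₂ k≢i | inj₂ k≢j =
  trans (transpose-fixes (k≢i ∘ ι-injective) (k≢j ∘ ι-injective)) (cong ι (sym (transpose-fixes k≢i k≢j)))

double : ∀ {r} → Fin r → Fin r → Fin r → Fin r → Permutation′ r
double a b c d = transpose a b ∘ₚ transpose c d

double-natural : ∀ {r r′} {ι : Fin r′ → Fin r} → Injective _≡_ _≡_ ι → ∀ a b c d x →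
                 double (ι a) (ι b) (ι c) (ι d) ⟨$⟩ʳ ι x ≡ ι (double a b c d ⟨$⟩ʳ x)
double-natural ι-injective a b c d x =
  trans (cong (PC.transpose _ _) (transpose-natural ι-injective a b x)) (transpose-natural ι-injective c d _)

double-fixes : ∀ {r} {a b c d x : Fin r} → x ≢ a → x ≢ b → x ≢ c → x ≢ d →
               double a b c d ⟨$⟩ʳ x ≡ x
double-fixes x≢a x≢b x≢c x≢d =
  trans (cong (PC.transpose _ _) (transpose-fixes x≢a x≢b)) (transpose-fixes x≢c x≢d)

double-cancel : ∀ {r} (a b i j c d : Fin r) → double a b i j ∘ₚ double i j c d ≈ double a b c d
double-cancel a b i j c d x = cong (PC.transpose c d) (transpose-involutive i j (PC.transpose a b x))

double-swapˡ : ∀ {r} (a b c d : Fin r) → double a b c d ≈ double b a c d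
double-swapˡ a b c d x = cong (PC.transpose c d) (transpose-comm a b x)

double-swapʳ : ∀ {r} (a b c d : Fin r) → double a b c d ≈ double a b d c
double-swapʳ a b c d x = transpose-comm c d (PC.transpose a b x)

HomotopyInvariant : (G : Graph) {r : ℕ} → (V G → Fin r) → Permutation′ r → Set
HomotopyInvariant G {r} f σ = Chain G (K r) f ((σ ⟨$⟩ʳ_) ∘ f)

DoubleInvariant : (G : Graph) {r : ℕ} → (V G → Fin r) → Set
DoubleInvariant G f = ∀ a b c d → a ≢ b → c ≢ d → HomotopyInvariant G f (double a b c d)

module _ {G : Graph} {r : ℕ} {f : V G → Fin r} where

  homotopyInvariant-id : IsHom G (K r) f → HomotopyInvariant G f id
  homotopyInvariant-id f-hom = done f-hom (λ _ → refl)

  homotopyInvariant-resp : ∀ σ τ → σ ≈ τ → HomotopyInvariant G f σ → HomotopyInvariant G f τ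
  homotopyInvariant-resp _ _ σ≈τ = chain-respʳ (σ≈τ ∘ f)

  homotopyInvariant-∘ₚ : ∀ σ τ → HomotopyInvariant G f σ → HomotopyInvariant G f τ →
                         HomotopyInvariant G f (σ ∘ₚ τ)
  homotopyInvariant-∘ₚ σ τ f≃σf f≃τf = chain-trans f≃τf (chain-postcompose (permutation-isHom τ) f≃σf)

  homotopyInvariant-even : IsHom G (K r) f → DoubleInvariant G f → ∀ π → IsEvenPerm π →
                           HomotopyInvariant G f π
  homotopyInvariant-even f-hom f-inv π (ts , proper , 2∣∣ts∣ , ts≈π) =
    homotopyInvariant-resp (eval ts) π ts≈π (eval-invariant ts proper 2∣∣ts∣)
    where
    eval-invariant : ∀ ts → List.All (λ t → proj₁ t ≢ proj₂ t) ts → 2 ∣ length ts →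
                     HomotopyInvariant G f (eval ts)
    eval-invariant []       _ _   = homotopyInvariant-id f-hom
    eval-invariant (_ ∷ []) _ 2∣1 with () ← ∣1⇒≡1 2∣1
    eval-invariant ((a , b) ∷ (c , d) ∷ ts) (a≢b List.∷ c≢d List.∷ proper) 2∣2+ =
      homotopyInvariant-∘ₚ (double a b c d) (eval ts) (f-inv a b c d a≢b c≢d)
        (eval-invariant ts proper (∣m+n∣m⇒∣n 2∣2+ ∣-refl))

EdgeCompatible : (G′ : Graph) → Maybe (V G′) → Maybe (V G′) → Set
EdgeCompatible G′ (just u) (just v) = E G′ u v
EdgeCompatible G′ nothing  nothing  = ⊥
EdgeCompatible G′ _        _        = ⊤

module Lift {G G′ : Graph} {r : ℕ} (restrict : V G → Maybe (V G′))
            (restrict-edge : ∀ u v → E G u v → EdgeCompatible G′ (restrict u) (restrict v))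
            {ι : Fin r → Fin (suc r)} (ι-injective : Injective _≡_ _≡_ ι)
            (z : Fin (suc r)) (ι≢z : ∀ a → ι a ≢ z) where

  extend : (V G′ → Fin r) → V G → Fin (suc r)
  extend g v = maybe′ (ι ∘ g) z (restrict v)

  extend-∼ : ∀ {g h} → Rel∼ G′ (K r) g h → Rel∼ G (K (suc r)) (extend g) (extend h)
  extend-∼ g∼h u v uv with restrict u | restrict v | restrict-edge u v uv
  ... | just u′ | just v′ | u′v′ = g∼h u′ v′ u′v′ ∘ ι-injective
  ... | just _  | nothing | _    = ι≢z _
  ... | nothing | just _  | _    = ι≢z _ ∘ sym

  extend-cong : ∀ {g h} → g ≗ h → extend g ≗ extend h
  extend-cong g≗h v with restrict v
  ... | just v′ = cong ι (g≗h v′)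
  ... | nothing = refl

  extend-chain : ∀ {g h} → Chain G′ (K r) g h → Chain G (K (suc r)) (extend g) (extend h)
  extend-chain (done g-hom g≗h)     = done (extend-∼ g-hom) (extend-cong g≗h)
  extend-chain (step p g-hom g∼p c) = step (extend p) (extend-∼ g-hom) (extend-∼ g∼p) (extend-chain c)

  module _ {f : V G → Fin (suc r)} {f′ : V G′ → Fin r} (f-hom : IsHom G (K (suc r)) f)
           (f-extends : ∀ v → Maybe.All (λ v′ → ι (f′ v′) ≡ f v) (restrict v)) where

    f∼extend : Rel∼ G (K (suc r)) f (extend f′)
    f∼extend u v uv with restrict u | restrict v | restrict-edge u v uv | f-extends u | f-extends v
    ... | _       | just _  | _  | _          | just ι≡fv = λ fu≡ → f-hom u v uv (trans fu≡ ι≡fv)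
    ... | just _  | nothing | _  | just ι≡fu  | _         = λ fu≡z → ι≢z _ (trans ι≡fu fu≡z)
    ... | nothing | nothing | () | _          | _

    extend∼f : Rel∼ G (K (suc r)) (extend f′) f
    extend∼f u v uv with restrict u | restrict v | restrict-edge u v uv | f-extends u | f-extends v
    ... | just _  | _       | _  | just ι≡fu | _         = λ ≡fv → f-hom u v uv (trans (sym ι≡fu) ≡fv)
    ... | nothing | just _  | _  | _         | just ι≡fv = λ z≡fv → ι≢z _ (trans ι≡fv (sym z≡fv))
    ... | nothing | nothing | () | _         | _

    -- f ∼ extend f′ ∼ f, so a chain for f′ sits between two single steps.
    lift : ∀ σ σ′ → σ ⟨$⟩ʳ z ≡ z → (∀ a → σ ⟨$⟩ʳ ι a ≡ ι (σ′ ⟨$⟩ʳ a)) →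
           HomotopyInvariant G′ f′ σ′ → HomotopyInvariant G f σ
    lift σ σ′ σz≡z σι≡ισ′ f′≃σ′f′ =
      chain-trans (chain-single f-hom extend-hom f∼extend)
        (chain-trans (chain-respʳ extend-σ′ (extend-chain f′≃σ′f′))
          (chain-postcompose (permutation-isHom σ) (chain-single extend-hom f-hom extend∼f)))
      where
      extend-hom : IsHom G (K (suc r)) (extend f′)
      extend-hom = extend-∼ (chain-homˡ f′≃σ′f′)

      extend-σ′ : extend ((σ′ ⟨$⟩ʳ_) ∘ f′) ≗ (σ ⟨$⟩ʳ_) ∘ extend f′
      extend-σ′ v with restrict v
      ... | just v′ = sym (σι≡ισ′ (f′ v′))
      ... | nothing = sym σz≡z

    lift-double : ∀ a b c d → HomotopyInvariant G′ f′ (double a b c d) →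
                  HomotopyInvariant G f (double (ι a) (ι b) (ι c) (ι d))
    lift-double a b c d = lift (double (ι a) (ι b) (ι c) (ι d)) (double a b c d)
      (double-fixes (z≢ι a) (z≢ι b) (z≢ι c) (z≢ι d))
      (double-natural ι-injective a b c d)
      where
      z≢ι : ∀ x → z ≢ ι x
      z≢ι x = ≢-sym (ι≢z x)

_∈ℕ_ : ℕ → ∀ {m} → Subset m → Set
i     ∈ℕ []            = ⊥
zero  ∈ℕ (inside  ∷ _) = ⊤
zero  ∈ℕ (outside ∷ _) = ⊥
suc i ∈ℕ (_ ∷ S)       = i ∈ℕ S

min-∈ : ∀ {m} (S : Subset m) → 1 ≤ ∣ S ∣ → minℕ S ∈ℕ S
min-∈ (inside  ∷ S) _       = tt
min-∈ (outside ∷ S) 1≤∣S∣   = min-∈ S 1≤∣S∣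

disjoint-∉ : ∀ {m} (S T : Subset m) {i} → Disjoint S T → i ∈ℕ S → ¬ i ∈ℕ T
disjoint-∉ (inside  ∷ S) (outside ∷ T) {suc i} S#T i∈S = disjoint-∉ S T S#T i∈S
disjoint-∉ (outside ∷ S) (_       ∷ T) {suc i} S#T i∈S = disjoint-∉ S T S#T i∈S
disjoint-∉ (inside  ∷ S) (inside  ∷ T) ()
disjoint-∉ (inside  ∷ S) (outside ∷ T) {zero} _ _ ()

disjoint⇒≢ : ∀ {m} (S T : Subset m) {i j} → Disjoint S T → i ∈ℕ S → j ∈ℕ T → i ≢ j
disjoint⇒≢ S T S#T i∈S j∈T refl = disjoint-∉ S T S#T i∈S j∈T

semiStable-bound : ∀ {m} (S : Subset m) → SemiStable S → ∣ S ∣ + ∣ S ∣ + minℕ S ≤ suc m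
semiStable-bound []                    _  = z≤n
semiStable-bound (inside ∷ [])         _  = s≤s (s≤s z≤n)
semiStable-bound (inside ∷ outside ∷ S) ss = begin
  suc ∣ S ∣ + suc ∣ S ∣ + 0 ≡⟨ ℕₚ.+-identityʳ _ ⟩
  suc (∣ S ∣ + suc ∣ S ∣)   ≡⟨ cong suc (ℕₚ.+-suc ∣ S ∣ ∣ S ∣) ⟩
  2 + (∣ S ∣ + ∣ S ∣)       ≤⟨ s≤s (s≤s (ℕₚ.≤-trans (ℕₚ.m≤m+n _ _) (semiStable-bound S ss))) ⟩
  2 + suc _                 ∎
  where open ℕₚ.≤-Reasoning
semiStable-bound (outside ∷ S) ss = begin
  ∣ S ∣ + ∣ S ∣ + suc (minℕ S) ≡⟨ ℕₚ.+-suc (∣ S ∣ + ∣ S ∣) (minℕ S) ⟩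
  suc (∣ S ∣ + ∣ S ∣ + minℕ S) ≤⟨ s≤s (semiStable-bound S ss) ⟩
  suc (suc _)                  ∎
  where open ℕₚ.≤-Reasoning

dropMin : ∀ {m} → Subset m → Subset m
dropMin []            = []
dropMin (inside  ∷ S) = outside ∷ S
dropMin (outside ∷ S) = outside ∷ dropMin S

dropMin-⊆ : ∀ {m} (S : Subset m) {i} → i ∈ℕ dropMin S → i ∈ℕ S
dropMin-⊆ (inside  ∷ S) {suc i} i∈S = i∈S
dropMin-⊆ (outside ∷ S) {suc i} i∈S = dropMin-⊆ S i∈S

∣dropMin∣ : ∀ {m} (S : Subset m) → 1 ≤ ∣ S ∣ → suc ∣ dropMin S ∣ ≡ ∣ S ∣
∣dropMin∣ (inside  ∷ S) _     = refl
∣dropMin∣ (outside ∷ S) 1≤∣S∣ = ∣dropMin∣ S 1≤∣S∣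

dropMin-semiStable : ∀ {m} (S : Subset m) → SemiStable S → SemiStable (dropMin S)
dropMin-semiStable []                     _  = tt
dropMin-semiStable (inside ∷ [])          _  = tt
dropMin-semiStable (inside ∷ outside ∷ S) ss = ss
dropMin-semiStable (outside ∷ S)          ss = dropMin-semiStable S ss

min+2≤min-dropMin : ∀ {m} (S : Subset m) → SemiStable S → 2 ≤ ∣ S ∣ → 2 + minℕ S ≤ minℕ (dropMin S)
min+2≤min-dropMin (inside ∷ [])          _  (s≤s ())
min+2≤min-dropMin (inside ∷ outside ∷ S) _  _      = s≤s (s≤s z≤n)
min+2≤min-dropMin (outside ∷ S)          ss 2≤∣S∣  = s≤s (min+2≤min-dropMin S ss 2≤∣S∣)

∣init∣ : ∀ {m} (S : Subset (suc m)) → last S ≡ outside → ∣ init S ∣ ≡ ∣ S ∣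
∣init∣ (outside ∷ [])     _      = refl
∣init∣ (inside  ∷ x ∷ S) last≡ = cong suc (∣init∣ (x ∷ S) last≡)
∣init∣ (outside ∷ x ∷ S) last≡ = ∣init∣ (x ∷ S) last≡

min-init : ∀ {m} (S : Subset (suc m)) → last S ≡ outside → 1 ≤ ∣ S ∣ → minℕ (init S) ≡ minℕ S
min-init (outside ∷ [])    _     ()
min-init (inside  ∷ x ∷ S) _     _     = refl
min-init (outside ∷ x ∷ S) last≡ 1≤∣S∣ = cong suc (min-init (x ∷ S) last≡ 1≤∣S∣)

init-semiStable : ∀ {m} (S : Subset (suc m)) → SemiStable S → SemiStable (init S)
init-semiStable (_ ∷ [])                    _  = tt
init-semiStable (inside ∷ outside ∷ [])     _  = tt
init-semiStable (inside ∷ outside ∷ x ∷ S)  ss = init-semiStable (x ∷ S) ss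
init-semiStable (outside ∷ x ∷ S)           ss = init-semiStable (x ∷ S) ss

init-disjoint : ∀ {m} (S T : Subset (suc m)) → Disjoint S T → Disjoint (init S) (init T)
init-disjoint (_       ∷ [])    (_       ∷ [])    _   = tt
init-disjoint (inside  ∷ x ∷ S) (outside ∷ y ∷ T) S#T = init-disjoint (x ∷ S) (y ∷ T) S#T
init-disjoint (outside ∷ x ∷ S) (_       ∷ y ∷ T) S#T = init-disjoint (x ∷ S) (y ∷ T) S#T

last-disjoint : ∀ {m} (S T : Subset (suc m)) → last S ≡ inside → last T ≡ inside → ¬ Disjoint S T
last-disjoint (inside  ∷ [])    (inside  ∷ [])    _ _ ()
last-disjoint (inside  ∷ x ∷ S) (outside ∷ y ∷ T) = last-disjoint (x ∷ S) (y ∷ T)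
last-disjoint (outside ∷ x ∷ S) (_       ∷ y ∷ T) = last-disjoint (x ∷ S) (y ∷ T)

-- SG n k is SemiStableKneser n (2 * n + k); the number m of points is kept free so that a
-- point can be deleted.
Vertex : ℕ → ℕ → Set
Vertex n m = Σ (Subset m) λ S → (∣ S ∣ ≡ n) × SemiStable S

SemiStableKneser : ℕ → ℕ → Graph
SemiStableKneser n m = record { V = Vertex n m ; E = λ S T → Disjoint (proj₁ S) (proj₁ T) }

IsMinColouring : ∀ {n m r} → (Vertex n m → Fin r) → Set
IsMinColouring f = ∀ v → toℕ (f v) ≡ minℕ (proj₁ v)

nonempty : ∀ {n m} → 1 ≤ n → (v : Vertex n m) → 1 ≤ ∣ proj₁ v ∣
nonempty 1≤n (_ , ∣S∣≡n , _) = subst (1 ≤_) (sym ∣S∣≡n) 1≤n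

module _ {n m : ℕ} where

  -- For m = 2 * n + k the hypothesis says r = k + 2, the number of colours of SG̅_{n,k}.
  min<colours : ∀ {r} → m + 2 ≡ 2 * n + r → (v : Vertex n m) → minℕ (proj₁ v) < r
  min<colours {r} m+2≡ (S , refl , ss) = ℕₚ.+-cancelˡ-≤ (∣ S ∣ + ∣ S ∣) _ _ (begin
    ∣ S ∣ + ∣ S ∣ + suc (minℕ S) ≡⟨ ℕₚ.+-suc (∣ S ∣ + ∣ S ∣) (minℕ S) ⟩
    suc (∣ S ∣ + ∣ S ∣ + minℕ S) ≤⟨ s≤s (semiStable-bound S ss) ⟩
    2 + m                        ≡⟨ ℕₚ.+-comm 2 m ⟩
    m + 2                        ≡⟨ m+2≡ ⟩
    2 * ∣ S ∣ + r                ≡⟨ cong (λ x → ∣ S ∣ + x + r) (ℕₚ.+-identityʳ ∣ S ∣) ⟩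
    ∣ S ∣ + ∣ S ∣ + r            ∎)
    where open ℕₚ.≤-Reasoning

  minColouring : ∀ {r} → m + 2 ≡ 2 * n + r → Vertex n m → Fin r
  minColouring m+2≡ v = fromℕ< (min<colours m+2≡ v)

  minColouring-isMin : ∀ {r} (m+2≡ : m + 2 ≡ 2 * n + r) → IsMinColouring (minColouring m+2≡)
  minColouring-isMin m+2≡ v = Finₚ.toℕ-fromℕ< (min<colours m+2≡ v)

  isMin⇒isHom : ∀ {r} {f : Vertex n m → Fin r} → 1 ≤ n → IsMinColouring f →
                IsHom (SemiStableKneser n m) (K r) f
  isMin⇒isHom {f = f} 1≤n f-min u v u#v fu≡fv =
    disjoint⇒≢ (proj₁ u) (proj₁ v) u#v
      (min-∈ (proj₁ u) (nonempty 1≤n u)) (min-∈ (proj₁ v) (nonempty 1≤n v))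
      (trans (sym (f-min u)) (trans (cong toℕ fu≡fv) (f-min v)))

  dropFirst : Vertex n (suc m) → Maybe (Vertex n m)
  dropFirst (inside  ∷ S , _)         = nothing
  dropFirst (outside ∷ S , ∣S∣≡n , ss) = just (S , ∣S∣≡n , ss)

  dropFirst-edge : ∀ u v → Disjoint (proj₁ u) (proj₁ v) →
                   EdgeCompatible (SemiStableKneser n m) (dropFirst u) (dropFirst v)
  dropFirst-edge (inside  ∷ S , _) (outside ∷ T , _) _   = tt
  dropFirst-edge (outside ∷ S , _) (inside  ∷ T , _) _   = tt
  dropFirst-edge (outside ∷ S , _) (outside ∷ T , _) S#T = S#T

  dropFirst-min : ∀ v → Maybe.All (λ v′ → suc (minℕ (proj₁ v′)) ≡ minℕ (proj₁ v)) (dropFirst v)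
  dropFirst-min (inside  ∷ S , _) = nothing
  dropFirst-min (outside ∷ S , _) = just refl

  restrictToInit : (S : Subset (suc m)) → ∣ S ∣ ≡ n → SemiStable S →
                   ∀ b → last S ≡ b → Maybe (Vertex n m)
  restrictToInit S _     _  inside  _     = nothing
  restrictToInit S ∣S∣≡n ss outside last≡ =
    just (init S , trans (∣init∣ S last≡) ∣S∣≡n , init-semiStable S ss)

  dropLast : Vertex n (suc m) → Maybe (Vertex n m)
  dropLast (S , ∣S∣≡n , ss) = restrictToInit S ∣S∣≡n ss (last S) refl

  dropLast-edge : ∀ u v → Disjoint (proj₁ u) (proj₁ v) →
                  EdgeCompatible (SemiStableKneser n m) (dropLast u) (dropLast v)
  dropLast-edge (S , ∣S∣≡n , ssS) (T , ∣T∣≡n , ssT) S#T = edge (last S) refl (last T) refl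
    where
    edge : ∀ b (lastS : last S ≡ b) c (lastT : last T ≡ c) → EdgeCompatible (SemiStableKneser n m)
             (restrictToInit S ∣S∣≡n ssS b lastS) (restrictToInit T ∣T∣≡n ssT c lastT)
    edge inside  lastS inside  lastT = last-disjoint S T lastS lastT S#T
    edge inside  _     outside _     = tt
    edge outside _     inside  _     = tt
    edge outside _     outside _     = init-disjoint S T S#T

  dropLast-min : 1 ≤ n → ∀ v → Maybe.All (λ v′ → minℕ (proj₁ v′) ≡ minℕ (proj₁ v)) (dropLast v)
  dropLast-min 1≤n v@(S , ∣S∣≡n , ss) = min≡ (last S) refl
    where
    min≡ : ∀ b (last≡ : last S ≡ b) →
           Maybe.All (λ v′ → minℕ (proj₁ v′) ≡ minℕ S) (restrictToInit S ∣S∣≡n ss b last≡)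
    min≡ inside  _     = nothing
    min≡ outside last≡ = just (min-init S last≡ (nonempty 1≤n v))

-- SG̅_{2,1}: vertex x is the semi-stable pair {lo x, hi x} ⊆ {0, …, 4}.
lo hi : Fin 6 → ℕ
lo = lookup (0 ∷ 0 ∷ 0 ∷ 1 ∷ 1 ∷ 2 ∷ [])
hi = lookup (2 ∷ 3 ∷ 4 ∷ 3 ∷ 4 ∷ 4 ∷ [])

Apart : Fin 6 → Fin 6 → Set
Apart x y = lo x ≢ lo y × lo x ≢ hi y × hi x ≢ lo y × hi x ≢ hi y

SG₂₁ : Graph
SG₂₁ = record { V = Fin 6 ; E = Apart }

-- Facts decided by evaluation are opaque so that later type checking never unfolds their proofs.
opaque
  stablePair-exists : ∀ {b} → b < 5 → ∀ {a} → a < 5 → 2 + a ≤ b → ∃[ x ] lo x ≡ a × hi x ≡ b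
  stablePair-exists = from-yes (ℕₚ.allUpTo? (λ b → ℕₚ.allUpTo? (λ a → (2 + a ≤? b) →-dec
    Finₚ.any? (λ x → (lo x ℕₚ.≟ a) ×-dec (hi x ℕₚ.≟ b))) 5) 5)

_∼?_ : (f g : Fin 6 → Fin 3) → Dec (Rel∼ SG₂₁ (K 3) f g)
f ∼? g = Finₚ.all? λ x → Finₚ.all? λ y →
  (¬? (lo x ℕₚ.≟ lo y) ×-dec ¬? (lo x ℕₚ.≟ hi y) ×-dec
   ¬? (hi x ℕₚ.≟ lo y) ×-dec ¬? (hi x ℕₚ.≟ hi y))
  →-dec ¬? (f x Finₚ.≟ g y)

-- the rotation 0 ↦ 1 ↦ 2 ↦ 0
ρ : Permutation′ 3
ρ = double 1F 2F 0F 1F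

-- t₀ is the min-colouring of SG̅_{2,1}; t₀, t₁, …, t₄, ρ ∘ t₀ are the successive steps of a chain.
t₀ t₁ t₂ t₃ t₄ : Fin 6 → Fin 3
t₀ = lookup (0F ∷ 0F ∷ 0F ∷ 1F ∷ 1F ∷ 2F ∷ [])
t₁ = lookup (0F ∷ 0F ∷ 0F ∷ 1F ∷ 2F ∷ 2F ∷ [])
t₂ = lookup (0F ∷ 1F ∷ 0F ∷ 1F ∷ 2F ∷ 2F ∷ [])
t₃ = lookup (0F ∷ 1F ∷ 0F ∷ 1F ∷ 2F ∷ 0F ∷ [])
t₄ = lookup (0F ∷ 1F ∷ 0F ∷ 2F ∷ 2F ∷ 0F ∷ [])

opaque
  t₀-lo : ∀ x → toℕ (t₀ x) ≡ lo x
  t₀-lo = from-yes (Finₚ.all? λ x → toℕ (t₀ x) ℕₚ.≟ lo x)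

t₀-rotation : HomotopyInvariant SG₂₁ t₀ ρ
t₀-rotation = via t₁ (via t₂ (via t₃ (via t₄ (via ((ρ ⟨$⟩ʳ_) ∘ t₀) stay))))
  where
  via : ∀ {f g} p {f-hom : True (f ∼? f)} {f∼p : True (f ∼? p)} →
        Chain SG₂₁ (K 3) p g → Chain SG₂₁ (K 3) f g
  via p {f-hom} {f∼p} = step p (toWitness f-hom) (toWitness f∼p)

  stay : ∀ {f} {f-hom : True (f ∼? f)} → Chain SG₂₁ (K 3) f f
  stay {f-hom = f-hom} = done (toWitness f-hom) (λ _ → refl)

_≈?_ : (σ τ : Permutation′ 3) → Dec (σ ≈ τ)
σ ≈? τ = Finₚ.all? λ x → σ ⟨$⟩ʳ x Finₚ.≟ τ ⟨$⟩ʳ x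

opaque
  double-is-rotation : ∀ (a b c d : Fin 3) → a ≢ b → c ≢ d →
                       double a b c d ≈ id ⊎ double a b c d ≈ ρ ⊎ double a b c d ≈ ρ ∘ₚ ρ
  double-is-rotation = from-yes (Finₚ.all? λ a → Finₚ.all? λ b → Finₚ.all? λ c → Finₚ.all? λ d →
    ¬? (a Finₚ.≟ b) →-dec ¬? (c Finₚ.≟ d) →-dec
    (double a b c d ≈? id ⊎-dec double a b c d ≈? ρ ⊎-dec double a b c d ≈? (ρ ∘ₚ ρ)))

module Base {n : ℕ} (2≤n : 2 ≤ n) {f : Vertex n (suc (2 * n)) → Fin 3} (f-min : IsMinColouring f) where

  G : Graph
  G = SemiStableKneser n (suc (2 * n))

  secondMin : V G → ℕ
  secondMin v = minℕ (dropMin (proj₁ v))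

  1≤n : 1 ≤ n
  1≤n = ℕₚ.<⇒≤ 2≤n

  1≤∣dropMin∣ : ∀ (v : V G) → 1 ≤ ∣ dropMin (proj₁ v) ∣
  1≤∣dropMin∣ v@(S , ∣S∣≡n , _) =
    ℕₚ.≤-pred (subst (2 ≤_) (sym (trans (∣dropMin∣ S (nonempty 1≤n v)) ∣S∣≡n)) 2≤n)

  secondMin<5 : ∀ (v : V G) → secondMin v < 5
  secondMin<5 v@(S , ∣S∣≡n , ss) = min<colours m+2≡ (dropMin S , refl , dropMin-semiStable S ss)
    where
    arithmetic : ∀ s → suc (2 * suc s) + 2 ≡ 2 * s + 5
    arithmetic = solve-∀

    m+2≡ : suc (2 * n) + 2 ≡ 2 * ∣ dropMin S ∣ + 5
    m+2≡ = subst (λ x → suc (2 * x) + 2 ≡ 2 * ∣ dropMin S ∣ + 5)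
                 (trans (∣dropMin∣ S (nonempty 1≤n v)) ∣S∣≡n) (arithmetic ∣ dropMin S ∣)

  min+2≤secondMin : ∀ (v : V G) → 2 + minℕ (proj₁ v) ≤ secondMin v
  min+2≤secondMin v@(S , ∣S∣≡n , ss) = min+2≤min-dropMin S ss (subst (2 ≤_) (sym ∣S∣≡n) 2≤n)

  stablePair : ∀ (v : V G) → ∃[ x ] lo x ≡ minℕ (proj₁ v) × hi x ≡ secondMin v
  stablePair v =
    stablePair-exists (secondMin<5 v) (ℕₚ.<-trans min<secondMin (secondMin<5 v)) (min+2≤secondMin v)
    where
    min<secondMin : minℕ (proj₁ v) < secondMin v
    min<secondMin = ℕₚ.≤-trans (ℕₚ.n≤1+n _) (min+2≤secondMin v)

  smallestPair : V G → Fin 6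
  smallestPair = proj₁ ∘ stablePair

  lo-∈ : ∀ (v : V G) → lo (smallestPair v) ∈ℕ proj₁ v
  lo-∈ v@(S , _) = subst (λ i → i ∈ℕ S) (sym (proj₁ (proj₂ (stablePair v)))) (min-∈ S (nonempty 1≤n v))

  hi-∈ : ∀ (v : V G) → hi (smallestPair v) ∈ℕ proj₁ v
  hi-∈ v@(S , _) = subst (λ i → i ∈ℕ S) (sym (proj₂ (proj₂ (stablePair v))))
                         (dropMin-⊆ S (min-∈ (dropMin S) (1≤∣dropMin∣ v)))

  smallestPair-isHom : IsHom G SG₂₁ smallestPair
  smallestPair-isHom u v u#v =
    ≢ (lo-∈ u) (lo-∈ v) , ≢ (lo-∈ u) (hi-∈ v) , ≢ (hi-∈ u) (lo-∈ v) , ≢ (hi-∈ u) (hi-∈ v)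
    where
    ≢ : ∀ {i j} → i ∈ℕ proj₁ u → j ∈ℕ proj₁ v → i ≢ j
    ≢ = disjoint⇒≢ (proj₁ u) (proj₁ v) u#v

  t₀∘smallestPair≗f : t₀ ∘ smallestPair ≗ f
  t₀∘smallestPair≗f v = Finₚ.toℕ-injective (begin
    toℕ (t₀ (smallestPair v)) ≡⟨ t₀-lo (smallestPair v) ⟩
    lo (smallestPair v)       ≡⟨ proj₁ (proj₂ (stablePair v)) ⟩
    minℕ (proj₁ v)            ≡⟨ f-min v ⟨
    toℕ (f v)                 ∎)
    where open ≡-Reasoning

  f-rotation : HomotopyInvariant G f ρ
  f-rotation = chain-respˡ t₀∘smallestPair≗f
    (chain-respʳ (cong (ρ ⟨$⟩ʳ_) ∘ t₀∘smallestPair≗f)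
      (chain-precompose {h = smallestPair} smallestPair-isHom t₀-rotation))

  doubleInvariant : DoubleInvariant G f
  doubleInvariant a b c d a≢b c≢d with double-is-rotation a b c d a≢b c≢d
  ... | inj₁ ≈id        = homotopyInvariant-resp id (double a b c d) (sym ∘ ≈id)
                            (homotopyInvariant-id (chain-homˡ f-rotation))
  ... | inj₂ (inj₁ ≈ρ)  = homotopyInvariant-resp ρ (double a b c d) (sym ∘ ≈ρ) f-rotation
  ... | inj₂ (inj₂ ≈ρρ) = homotopyInvariant-resp (ρ ∘ₚ ρ) (double a b c d) (sym ∘ ≈ρρ)
                            (homotopyInvariant-∘ₚ ρ ρ f-rotation f-rotation)

module Step {k n : ℕ} (1≤n : 1 ≤ n)
            {f′ : Vertex n (k + suc (2 * n)) → Fin (3 + k)} (f′-min : IsMinColouring f′)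
            (f′-invariant : DoubleInvariant (SemiStableKneser n (k + suc (2 * n))) f′)
            {f : Vertex n (suc k + suc (2 * n)) → Fin (4 + k)} (f-min : IsMinColouring f) where

  G : Graph
  G = SemiStableKneser n (suc k + suc (2 * n))

  f-hom : IsHom G (K (4 + k)) f
  f-hom = isMin⇒isHom 1≤n f-min

  doubleInvariant-inject₁ : ∀ a b c d → a ≢ b → c ≢ d →
                            HomotopyInvariant G f (double (inject₁ a) (inject₁ b) (inject₁ c) (inject₁ d))
  doubleInvariant-inject₁ a b c d a≢b c≢d =
    Lift.lift-double dropLast dropLast-edge {ι = inject₁} Finₚ.inject₁-injective
      (fromℕ (3 + k)) (λ _ → ≢-sym Finₚ.fromℕ≢inject₁) f-hom extends a b c d
      (f′-invariant a b c d a≢b c≢d)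
    where
    extends : ∀ v → Maybe.All (λ v′ → inject₁ (f′ v′) ≡ f v) (dropLast v)
    extends v = Maybe.map (λ {v′} min≡ → Finₚ.toℕ-injective
      (trans (Finₚ.toℕ-inject₁ (f′ v′)) (trans (f′-min v′) (trans min≡ (sym (f-min v))))))
      (dropLast-min 1≤n v)

  doubleInvariant-suc : ∀ a b c d → a ≢ b → c ≢ d →
                        HomotopyInvariant G f (double (Fin.suc a) (Fin.suc b) (Fin.suc c) (Fin.suc d))
  doubleInvariant-suc a b c d a≢b c≢d =
    Lift.lift-double dropFirst dropFirst-edge {ι = Fin.suc} Finₚ.suc-injective
      0F (λ _ ()) f-hom extends a b c d (f′-invariant a b c d a≢b c≢d)
    where
    extends : ∀ v → Maybe.All (λ v′ → Fin.suc (f′ v′) ≡ f v) (dropFirst v)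
    extends v = Maybe.map (λ {v′} min≡ → Finₚ.toℕ-injective
      (trans (cong suc (f′-min v′)) (trans min≡ (sym (f-min v)))))
      (dropFirst-min v)

  t : Fin (4 + k)
  t = fromℕ (3 + k)

  -- (0 t)(1 2) = A B A, where A fixes t and B fixes 0.
  A B : Permutation′ (4 + k)
  A = double 1F 2F 0F 1F
  B = double 1F t 1F 2F

  ABA-invariant : HomotopyInvariant G f (A ∘ₚ B ∘ₚ A)
  ABA-invariant =
    homotopyInvariant-∘ₚ A (B ∘ₚ A) A-invariant (homotopyInvariant-∘ₚ B A B-invariant A-invariant)
    where
    A-invariant = doubleInvariant-inject₁ 1F 2F 0F 1F (λ ()) (λ ())
    B-invariant = doubleInvariant-suc 0F (fromℕ (2 + k)) 0F 1F (λ ()) (λ ())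

  double-12-0t : double 1F 2F 0F t ≈ A ∘ₚ B ∘ₚ A
  double-12-0t 0F = refl
  double-12-0t 1F = refl
  double-12-0t 2F = refl
  double-12-0t (Fin.suc (Fin.suc (Fin.suc w))) with toSum (w Finₚ.≟ fromℕ k)
  ... | inj₁ refl rewrite dec-true (fromℕ k Finₚ.≟ fromℕ k) refl = refl
  ... | inj₂ w≢t  rewrite dec-false (w Finₚ.≟ fromℕ k) w≢t      = refl

  double-0t-12 : double 0F t 1F 2F ≈ A ∘ₚ B ∘ₚ A
  double-0t-12 0F = refl
  double-0t-12 1F = refl
  double-0t-12 2F = refl
  double-0t-12 (Fin.suc (Fin.suc (Fin.suc w))) with toSum (w Finₚ.≟ fromℕ k)
  ... | inj₁ refl rewrite dec-true (fromℕ k Finₚ.≟ fromℕ k) refl = refl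
  ... | inj₂ w≢t  rewrite dec-false (w Finₚ.≟ fromℕ k) w≢t      = refl

  Invariant₁₂ : Fin (4 + k) → Fin (4 + k) → Set
  Invariant₁₂ x y = HomotopyInvariant G f (double 1F 2F x y) × HomotopyInvariant G f (double x y 1F 2F)

  invariant₁₂-0 : ∀ y → 0F ≢ y → Invariant₁₂ 0F y
  invariant₁₂-0 y 0≢y with view y
  ... | ‵fromℕ      =
      homotopyInvariant-resp (A ∘ₚ B ∘ₚ A) (double 1F 2F 0F t) (sym ∘ double-12-0t) ABA-invariant
    , homotopyInvariant-resp (A ∘ₚ B ∘ₚ A) (double 0F t 1F 2F) (sym ∘ double-0t-12) ABA-invariant
  ... | ‵inject₁ y′ = doubleInvariant-inject₁ 1F 2F 0F y′ (λ ()) (0≢y ∘ cong inject₁)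
                    , doubleInvariant-inject₁ 0F y′ 1F 2F (0≢y ∘ cong inject₁) (λ ())

  invariant₁₂ : ∀ x y → x ≢ y → Invariant₁₂ x y
  invariant₁₂ 0F          y           0≢y = invariant₁₂-0 y 0≢y
  invariant₁₂ (Fin.suc x) 0F          x≢0 =
    let inv₁ , inv₂ = invariant₁₂-0 (Fin.suc x) (≢-sym x≢0)
    in  homotopyInvariant-resp (double 1F 2F 0F (Fin.suc x)) (double 1F 2F (Fin.suc x) 0F)
          (double-swapʳ 1F 2F 0F (Fin.suc x)) inv₁
      , homotopyInvariant-resp (double 0F (Fin.suc x) 1F 2F) (double (Fin.suc x) 0F 1F 2F)
          (double-swapˡ 0F (Fin.suc x) 1F 2F) inv₂
  invariant₁₂ (Fin.suc x) (Fin.suc y) x≢y =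
      doubleInvariant-suc 0F 1F x y (λ ()) (x≢y ∘ cong Fin.suc)
    , doubleInvariant-suc x y 0F 1F (x≢y ∘ cong Fin.suc) (λ ())

  doubleInvariant : DoubleInvariant G f
  doubleInvariant a b c d a≢b c≢d =
    homotopyInvariant-resp (double a b 1F 2F ∘ₚ double 1F 2F c d) (double a b c d)
      (double-cancel a b 1F 2F c d)
      (homotopyInvariant-∘ₚ (double a b 1F 2F) (double 1F 2F c d)
        (proj₂ (invariant₁₂ a b a≢b)) (proj₁ (invariant₁₂ c d c≢d)))

level-size : ∀ n k → k + suc (2 * n) + 2 ≡ 2 * n + (3 + k)
level-size = solve-∀

-- Stage k is SG̅_{n,k+1}: 3 + k colours on k + suc (2 * n) points, so stage suc k has
-- definitionally one point more.
minColouring-doubleInvariant : ∀ k n {m} → m ≡ k + suc (2 * n) → 2 ≤ n →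
                               {f : Vertex n m → Fin (3 + k)} → IsMinColouring f →
                               DoubleInvariant (SemiStableKneser n m) f
minColouring-doubleInvariant zero    n refl 2≤n f-min = Base.doubleInvariant 2≤n f-min
minColouring-doubleInvariant (suc k) n refl 2≤n f-min =
  Step.doubleInvariant (ℕₚ.<⇒≤ 2≤n) (minColouring-isMin (level-size n k))
    (minColouring-doubleInvariant k n refl 2≤n (minColouring-isMin (level-size n k))) f-min

c-isMin : ∀ n k → IsMinColouring (c n k)
c-isMin n k v with minℕ (proj₁ v) <? 2 + k
... | yes min<2+k = Finₚ.toℕ-fromℕ< min<2+k
... | no  min≮2+k = ⊥-elim (min≮2+k (min<colours (size n k) v))
  where
  size : ∀ n k → 2 * n + k + 2 ≡ 2 * n + (2 + k)
  size = solve-∀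

proposition4p4 : (n k : ℕ) → 2 ≤ n → 1 ≤ k → (π : Permutation′ (2 + k)) → IsEvenPerm π
    → Homotopic (SG n k) (K (2 + k)) (c n k) (λ S → π ⟨$⟩ʳ c n k S)
proposition4p4 n (suc k) 2≤n _ =
  homotopyInvariant-even (isMin⇒isHom (ℕₚ.<⇒≤ 2≤n) (c-isMin n (suc k)))
    (minColouring-doubleInvariant k n (level n) 2≤n (c-isMin n (suc k)))
  where
  level : ∀ n → 2 * n + suc k ≡ k + suc (2 * n)
  level = solve-∀
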